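{- Let $\langle (\mathsf{K}_{\Phi})_{\Phi \subseteq \mathsf{At}}, (f^{\Phi}_{\Psi})_{\Psi \subseteq \Phi \subseteq \mathsf{At}} \rangle$ be a category of FH models and let $\mathcal{F} \subseteq 2^{\mathsf{At}}$ be nonempty. Write $\Phi^\cup := \bigcup_{\Phi \in \mathcal{F}} \Phi$ and $\Phi^\cap := \bigcap_{\Phi \in \mathcal{F}} \Phi$. Then (i) for every $\Psi \in \mathcal{F}$, every $w \in W_{\Phi^\cup}$ and every $\varphi \in \mathcal{L}_\Psi$: $\mathsf{K}_{\Phi^\cup}, w \Vdash \varphi$ iff $\mathsf{K}_\Psi, f^{\Phi^\cup}_{\Psi}(w) \Vdash \varphi$; and (ii) for every $\Psi \in \mathcal{F}$, every $w \in W_\Psi$ and every $\varphi \in \mathcal{L}_{\Phi^\cap}$: $\mathsf{K}_\Psi, w \Vdash \varphi$ iff $\mathsf{K}_{\Phi^\cap}, f^{\Psi}_{\Phi^\cap}(w) \Vdash \varphi$. (In this sense modal equivalence relative to sublanguages forms a complete lattice of the FH models in the category.)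
   Context: Fix a nonempty set $\mathsf{At}$ of atoms and a nonempty set $I$ of agents. The language $\mathcal{L}_{\mathsf{At}}$ is given by $\varphi ::= \top \mid p \mid \neg\varphi \mid \varphi \wedge \psi \mid \ell_i\varphi \mid a_i\varphi \mid k_i\varphi$ ($p \in \mathsf{At}$, $i \in I$). $\mathsf{At}(\varphi)$ is the set of atoms occurring in $\varphi$, and $\mathcal{L}_\Phi := \{\varphi \in \mathcal{L}_{\mathsf{At}} : \mathsf{At}(\varphi) \subseteq \Phi\}$. For $\Phi \subseteq \mathsf{At}$, an FH model $\mathsf{K}_\Phi = \langle I, W_\Phi, (R_{\Phi,i})_{i \in I}, (\mathcal{A}_{\Phi,i})_{i \in I}, V_\Phi\rangle$ consists of a nonempty set $W_\Phi$, equivalence relations $R_{\Phi,i}$ on $W_\Phi$, awareness functions $\mathcal{A}_{\Phi,i} : W_\Phi \to 2^{\mathcal{L}_\Phi}$ and a valuation $V_\Phi : \Phi \to 2^{W_\Phi}$, such that $\varphi \in \mathcal{A}_{\Phi,i}(w)$ iff $p \in \mathcal{A}_{\Phi,i}(w)$ for all $p \in \mathsf{At}(\varphi)$, and $(w,t) \in R_{\Phi,i}$ implies $\mathcal{A}_{\Phi,i}(w) = \mathcal{A}_{\Phi,i}(t)$. Satisfaction for $\varphi \in \mathcal{L}_\Phi$: $\mathsf{K}_\Phi, w \Vdash \top$ always; $\Vdash p$ iff $w \in V_\Phi(p)$; $\Vdash \neg\varphi$ iff not $\Vdash \varphi$; $\Vdash \varphi \wedge \psi$ iff both; $\Vdash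 a_i\varphi$ iff $\varphi \in \mathcal{A}_{\Phi,i}(w)$; $\Vdash \ell_i\varphi$ iff $\mathsf{K}_\Phi, t \Vdash \varphi$ for all $t$ with $(w,t) \in R_{\Phi,i}$; $\Vdash k_i\varphi$ iff $\Vdash \ell_i\varphi$ and $\Vdash a_i\varphi$. For $\Psi \subseteq \Phi$, a surjective bounded morphism $f^\Phi_\Psi : \mathsf{K}_\Phi \to \mathsf{K}_\Psi$ is a surjection $W_\Phi \to W_\Psi$ such that for all $i$ and $w \in W_\Phi$: for $p \in \Psi$, $w \in V_\Phi(p)$ iff $f^\Phi_\Psi(w) \in V_\Psi(p)$; $\mathcal{A}_{\Phi,i}(w) \cap \mathcal{L}_\Psi = \mathcal{A}_{\Psi,i}(f^\Phi_\Psi(w))$; $(w,t) \in R_{\Phi,i}$ implies $(f^\Phi_\Psi(w), f^\Phi_\Psi(t)) \in R_{\Psi,i}$; and if $(f^\Phi_\Psi(w), t') \in R_{\Psi,i}$ then there is $t \in W_\Phi$ with $f^\Phi_\Psi(t) = t'$ and $(w,t) \in R_{\Phi,i}$. A category of FH models $\langle (\mathsf{K}_\Phi)_{\Phi \subseteq \mathsf{At}}, (f^\Phi_\Psi)_{\Psi \subseteq \Phi \subseteq \mathsf{At}}\rangle$ consists of an FH model $\mathsf{K}_\Phi$ for each $\Phi \subseteq \mathsf{At}$ and a surjective bounded morphism $f^\Phi_\Psi$ for each $\Psi \subseteq \Phi$, with $f^\Phi_\Phi$ the identity and $f^\Phi_\Upsilon = f^\Psi_\Upsilon \circ f^\Phi_\Psi$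 for $\Upsilon \subseteq \Psi \subseteq \Phi$. -}

module Defs where

open import Data.Bool using (Bool; true)
open import Data.Unit using () renaming (⊤ to Unit)
open import Data.Product using (Σ; _×_; _,_; ∃)
open import Relation.Nullary using (¬_)
open import Relation.Binary.PropositionalEquality using (_≡_)
open import Relation.Binary.Structures using (IsEquivalence)
open import Function.Bundles using (_⇔_; Equivalence)

Sub : Set → Set
Sub At = At → Bool

_∈ˢ_ : {At : Set} → At → Sub At → Set
p ∈ˢ Φ = Φ p ≡ true

_⊆ˢ_ : {At : Set} → Sub At → Sub At → Set
Ψ ⊆ˢ Φ = ∀ p → p ∈ˢ Ψ → p ∈ˢ Φ

data Form (At I : Set) : Set where
  ⊤'   : Form At I
  atom : At → Form At I
  ¬'_  : Form At I → Form At I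
  _∧'_ : Form At I → Form At I → Form At I
  ℓ    : I → Form At I → Form At I
  a    : I → Form At I → Form At I
  k    : I → Form At I → Form At I

AllAtoms : {At I : Set} → (At → Set) → Form At I → Set
AllAtoms P ⊤'       = Unit
AllAtoms P (atom p) = P p
AllAtoms P (¬' φ)   = AllAtoms P φ
AllAtoms P (φ ∧' ψ) = AllAtoms P φ × AllAtoms P ψ
AllAtoms P (ℓ i φ)  = AllAtoms P φ
AllAtoms P (a i φ)  = AllAtoms P φ
AllAtoms P (k i φ)  = AllAtoms P φ

InL : {At I : Set} → Sub At → Form At I → Set
InL Φ φ = AllAtoms (λ p → p ∈ˢ Φ) φ

record FHModel (At I : Set) (Φ : Sub At) : Set₁ where
  field
    W      : Set
    w₀     : W                                   -- W_Φ nonempty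
    R      : I → W → W → Set
    R-eq   : ∀ i → IsEquivalence (R i)
    A      : I → W → Form At I → Set
    A-⊆L   : ∀ i w φ → A i w φ → InL Φ φ
    A-gen  : ∀ i w φ → A i w φ ⇔ AllAtoms (λ p → A i w (atom p)) φ
    A-R    : ∀ i w t → R i w t → ∀ φ → (A i w φ ⇔ A i t φ)
    -- valuation; only its values on atoms of Φ are relevant
    V      : At → W → Set

module _ {At I : Set} {Φ : Sub At} (K : FHModel At I Φ) where
  open FHModel K

  Sat : W → Form At I → Set
  Sat w ⊤'       = Unit
  Sat w (atom p) = V p w
  Sat w (¬' φ)   = ¬ Sat w φ
  Sat w (φ ∧' ψ) = Sat w φ × Sat w ψ
  Sat w (ℓ i φ)  = ∀ t → R i w t → Sat t φ
  Sat w (a i φ)  = A i w φ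
  Sat w (k i φ)  = (∀ t → R i w t → Sat t φ) × A i w φ

record IsSBM {At I : Set} {Φ Ψ : Sub At}
             (KΦ : FHModel At I Φ) (KΨ : FHModel At I Ψ)
             (f : FHModel.W KΦ → FHModel.W KΨ) : Set where
  private
    module P = FHModel KΦ
    module S = FHModel KΨ
  field
    surj  : ∀ t' → ∃ λ w → f w ≡ t'
    val   : ∀ p → p ∈ˢ Ψ → ∀ w → P.V p w ⇔ S.V p (f w)
    aware : ∀ i w φ → (P.A i w φ × InL Ψ φ) ⇔ S.A i (f w) φ
    forth : ∀ i w t → P.R i w t → S.R i (f w) (f t)
    back  : ∀ i w t' → S.R i (f w) t' → ∃ λ t → f t ≡ t' × P.R i w t

record FHCategory (At I : Set) : Set₁ where
  field
    K     : (Φ : Sub At) → FHModel At I Φ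
    f     : (Φ Ψ : Sub At) → .(Ψ ⊆ˢ Φ) → FHModel.W (K Φ) → FHModel.W (K Ψ)
    f-sbm : (Φ Ψ : Sub At) .(h : Ψ ⊆ˢ Φ) → IsSBM (K Φ) (K Ψ) (f Φ Ψ h)
    f-id  : (Φ : Sub At) .(h : Φ ⊆ˢ Φ) → ∀ w → f Φ Φ h w ≡ w
    f-∘   : (Φ Ψ Υ : Sub At) .(hΨΦ : Ψ ⊆ˢ Φ) .(hΥΨ : Υ ⊆ˢ Ψ) .(hΥΦ : Υ ⊆ˢ Φ) →
            ∀ w → f Φ Υ hΥΦ w ≡ f Ψ Υ hΥΨ (f Φ Ψ hΨΦ w)

IsUnion : {At : Set} → (Sub At → Set) → Sub At → Set
IsUnion {At} 𝓕 U = ∀ (p : At) → p ∈ˢ U ⇔ (∃ λ Φ → 𝓕 Φ × p ∈ˢ Φ)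

IsInter : {At : Set} → (Sub At → Set) → Sub At → Set
IsInter {At} 𝓕 N = ∀ (p : At) → p ∈ˢ N ⇔ (∀ Φ → 𝓕 Φ → p ∈ˢ Φ)

∈⇒⊆∪ : {At : Set} {𝓕 : Sub At → Set} {U : Sub At} → IsUnion 𝓕 U →
       ∀ Ψ → 𝓕 Ψ → Ψ ⊆ˢ U
∈⇒⊆∪ hU Ψ FΨ p h = Equivalence.from (hU p) (Ψ , FΨ , h)

∈⇒∩⊆ : {At : Set} {𝓕 : Sub At → Set} {N : Sub At} → IsInter 𝓕 N →
       ∀ Ψ → 𝓕 Ψ → N ⊆ˢ Ψ
∈⇒∩⊆ hN Ψ FΨ p h = Equivalence.to (hN p) h Ψ FΨ

{-# OPTIONS --safe #-}
module Submission where

open import Defs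
open import Data.Product using (Σ; _×_; _,_; proj₁)
open import Data.Product.Function.NonDependent.Propositional using (_×-⇔_)
open import Function.Bundles using (_⇔_; mk⇔; Equivalence)
open import Function.Construct.Identity using (⇔-id)
open import Function.Related.TypeIsomorphisms using (¬-cong-⇔)
open import Relation.Binary.PropositionalEquality using (subst)

-- Both parts are instances of one fact: a bounded morphism K_Φ → K_Ψ
-- preserves and reflects truth of every formula of L_Ψ. By induction on the
-- formula: the forth and back conditions carry ℓ_i across, and awareness of
-- the two models agrees on L_Ψ. Each Ψ ∈ 𝓕 lies
-- between ⋂𝓕 and ⋃𝓕, so the category supplies the relevant morphisms.

module _ {At I : Set} {Φ Ψ : Sub At} {KΦ : FHModel At I Φ} {KΨ : FHModel At I Ψ}
         {f : FHModel.W KΦ → FHModel.W KΨ} (f-sbm : IsSBM KΦ KΨ f) where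
  private
    module P = FHModel KΦ
    module S = FHModel KΨ
    module M = IsSBM f-sbm
  open Equivalence

  aware-preserved : ∀ i w φ → InL Ψ φ → P.A i w φ ⇔ S.A i (f w) φ
  aware-preserved i w φ φ∈LΨ =
    mk⇔ (λ aw → to (M.aware i w φ) (aw , φ∈LΨ))
        (λ aw → proj₁ (from (M.aware i w φ) aw))

  box-preserved : ∀ i φ → (∀ t → Sat KΦ t φ ⇔ Sat KΨ (f t) φ) →
                  ∀ w → Sat KΦ w (ℓ i φ) ⇔ Sat KΨ (f w) (ℓ i φ)
  box-preserved i φ φ-preserved w = mk⇔ forward backward
    where
    forward : Sat KΦ w (ℓ i φ) → Sat KΨ (f w) (ℓ i φ)
    forward □φ t' fwRt' with M.back i w t' fwRt'
    ... | t , ft≡t' , wRt = subst (λ s → Sat KΨ s φ) ft≡t' (to (φ-preserved t) (□φ t wRt))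

    backward : Sat KΨ (f w) (ℓ i φ) → Sat KΦ w (ℓ i φ)
    backward □φ t wRt = from (φ-preserved t) (□φ (f t) (M.forth i w t wRt))

  Sat-preserved : ∀ w φ → InL Ψ φ → Sat KΦ w φ ⇔ Sat KΨ (f w) φ
  Sat-preserved w ⊤'       _           = ⇔-id _
  Sat-preserved w (atom p) p∈Ψ         = M.val p p∈Ψ w
  Sat-preserved w (¬' φ)   φ∈LΨ        = ¬-cong-⇔ (Sat-preserved w φ φ∈LΨ)
  Sat-preserved w (φ ∧' ψ) (φ∈LΨ , ψ∈LΨ) =
    Sat-preserved w φ φ∈LΨ ×-⇔ Sat-preserved w ψ ψ∈LΨ
  Sat-preserved w (ℓ i φ)  φ∈LΨ        =
    box-preserved i φ (λ t → Sat-preserved t φ φ∈LΨ) w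
  Sat-preserved w (a i φ)  φ∈LΨ        = aware-preserved i w φ φ∈LΨ
  Sat-preserved w (k i φ)  φ∈LΨ        =
    box-preserved i φ (λ t → Sat-preserved t φ φ∈LΨ) w ×-⇔ aware-preserved i w φ φ∈LΨ

proposition6 : (At I : Set) → At → I → (C : FHCategory At I) →
    (𝓕 : Sub At → Set) → Σ (Sub At) 𝓕 →
    (U N : Sub At) → (hU : IsUnion 𝓕 U) → (hN : IsInter 𝓕 N) →
    ((Ψ : Sub At) → (FΨ : 𝓕 Ψ) → (w : FHModel.W (FHCategory.K C U)) →
       (φ : Form At I) → InL Ψ φ →
       Sat (FHCategory.K C U) w φ
         ⇔ Sat (FHCategory.K C Ψ) (FHCategory.f C U Ψ (∈⇒⊆∪ hU Ψ FΨ) w) φ)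
    × ((Ψ : Sub At) → (FΨ : 𝓕 Ψ) → (w : FHModel.W (FHCategory.K C Ψ)) →
       (φ : Form At I) → InL N φ →
       Sat (FHCategory.K C Ψ) w φ
         ⇔ Sat (FHCategory.K C N) (FHCategory.f C Ψ N (∈⇒∩⊆ hN Ψ FΨ) w) φ)
proposition6 _ _ _ _ C _ _ U N hU hN =
    (λ Ψ FΨ → Sat-preserved (f-sbm U Ψ (∈⇒⊆∪ hU Ψ FΨ)))
  , (λ Ψ FΨ → Sat-preserved (f-sbm Ψ N (∈⇒∩⊆ hN Ψ FΨ)))
  where open FHCategory C
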